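{- If $\pi$ is a permutation that avoids $32\overline{4}1$ and ends in its largest entry, then there exists a permutation $\sigma$ with $s(\sigma)=\pi$ such that $\sigma$ avoids $32\overline{4}1$ and $\operatorname{LRmax}(\sigma)=\operatorname{LRmax}(\pi)$.
   Context: A permutation is an ordering of a finite set of positive integers, written in one-line notation. West's stack-sorting map $s$ is defined recursively: $s$ sends the empty permutation to itself, and for a nonempty permutation $\pi=LmR$ with $m$ its largest entry, $s(\pi)=s(L)\,s(R)\,m$. A permutation $\pi=\pi_1\cdots\pi_n$ contains the barred pattern $32\overline{4}1$ if there are indices $i_1<i_2<i_3$ with $\pi_{i_1}>\pi_{i_2}>\pi_{i_3}$ and $\pi_j<\pi_{i_1}$ for all $i_2<j<i_3$; otherwise it avoids $32\overline{4}1$. A left-to-right maximum of $\pi$ is an entry $\pi_j$ with $\pi_j>\pi_\ell$ for all $\ell<j$; $\operatorname{LRmax}(\pi)$ is the set of left-to-right maxima. -}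

module Defs where

open import Data.Nat using (ℕ; zero; suc; _<_; _⊔_; _≟_)
open import Data.List using (List; []; _∷_; _++_; [_]; length; lookup; break; foldr)
open import Data.List.Relation.Unary.All using (All)
open import Data.List.Relation.Unary.Unique.Propositional using (Unique)
open import Data.Fin using (Fin) renaming (_<_ to _<ᶠ_)
open import Data.Product using (Σ; ∃; _×_; _,_)
open import Relation.Nullary using (¬_)
open import Relation.Binary.PropositionalEquality using (_≡_)
open import Function.Bundles using (_⇔_)

IsPerm : List ℕ → Set
IsPerm π = Unique π × All (λ x → 0 < x) π

maxEntry : List ℕ → ℕ
maxEntry = foldr _⊔_ 0

-- Defined with fuel (= length) to make the
-- recursion structurally terminating; L and R are strictly shorter.
sFuel : ℕ → List ℕ → List ℕ
sFuel _ [] = []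
sFuel zero (x ∷ xs) = x ∷ xs   -- unreachable when fuel = length
sFuel (suc k) (x ∷ xs) with break (λ y → y ≟ maxEntry (x ∷ xs)) (x ∷ xs)
... | L , [] = sFuel k L          -- impossible: the maximum occurs
... | L , (m ∷ R) = sFuel k L ++ sFuel k R ++ [ m ]

s : List ℕ → List ℕ
s π = sFuel (length π) π

Contains32b41 : List ℕ → Set
Contains32b41 π =
  Σ (Fin (length π)) λ i₁ → Σ (Fin (length π)) λ i₂ → Σ (Fin (length π)) λ i₃ →
    (i₁ <ᶠ i₂) × (i₂ <ᶠ i₃) ×
    (lookup π i₂ < lookup π i₁) × (lookup π i₃ < lookup π i₂) ×
    (∀ (j : Fin (length π)) → i₂ <ᶠ j → j <ᶠ i₃ → lookup π j < lookup π i₁)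

Avoids32b41 : List ℕ → Set
Avoids32b41 π = ¬ Contains32b41 π

IsLRmax : List ℕ → ℕ → Set
IsLRmax π x = Σ (Fin (length π)) λ j →
  (lookup π j ≡ x) × (∀ (ℓ : Fin (length π)) → ℓ <ᶠ j → lookup π ℓ < lookup π j)

SameLRmax : List ℕ → List ℕ → Set
SameLRmax σ π = ∀ x → IsLRmax σ x ⇔ IsLRmax π x

EndsInMax : List ℕ → Set
EndsInMax π = Σ (List ℕ) λ L → Σ ℕ λ m → (π ≡ L ++ [ m ]) × All (λ y → y < m) L

-- Write π = L m and split L at its maximum m′, so π = P m′ B m with P and B below m′.  A descent
-- in B would form a 32‾41 together with m′, so B is increasing and s(B) = B.  By induction P m′
-- has a preimage σ′ of the required kind, and σ = σ′ m B works: s(σ) = s(σ′) s(B) m = P m′ B m,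
-- and the left-to-right maxima of both σ and π are those of P m′ together with m.  The invariant
-- carried along is that every descent top of σ is a left-to-right maximum; this excludes 32‾41,
-- since a descent must occur between the '2' and the '1', and its top lies below the '3'.
module Submission where

open import Defs
open import Level using (0ℓ)
open import Relation.Binary.PropositionalEquality hiding ([_])
open import Data.Bool using (true; false)
open import Data.Empty using (⊥; ⊥-elim)
open import Data.Unit using (⊤; tt)
open import Data.Nat using (ℕ; suc; _<_; _≤_; _⊔_; _+_; _≟_; _≡ᵇ_; _<?_; z≤n; z<s; s<s; s≤s⁻¹; s<s⁻¹)
open import Data.Nat.Properties
open import Data.Nat.Induction using (<-wellFounded)
open import Data.Fin using (Fin; zero; suc) renaming (_<_ to _<ᶠ_)
open import Data.List using (List; []; _∷_; _++_; [_]; _∷ʳ_; length; lookup; break)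
open import Data.List.Properties using (length-++; ++-assoc)
open import Data.List.Reverse using (Reverse; []; _∶_∶ʳ_; reverseView)
open import Data.List.Membership.Propositional using (_∈_)
open import Data.List.Membership.Propositional.Properties using (∈-++⁺ʳ)
open import Data.List.Relation.Unary.All as All using (All; []; _∷_)
import Data.List.Relation.Unary.All.Properties as All
open import Data.List.Relation.Unary.Any using (here; there)
open import Data.List.Relation.Unary.AllPairs using ([]; _∷_)
open import Data.List.Relation.Unary.First as First using (First; _∷_)
import Data.List.Relation.Unary.First.Properties as First
open import Data.List.Relation.Unary.Linked using (Linked; []; [-]; _∷_)
open import Data.List.Relation.Unary.Unique.Propositional using (Unique)
open import Data.List.Relation.Binary.Permutation.Propositional
  using (_↭_; ↭-refl; ↭-sym; ↭⇒↭ₛ; module PermutationReasoning)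
open import Data.List.Relation.Binary.Permutation.Propositional.Properties
  using (++⁺ʳ; ++⁺ˡ; ++-comm; All-resp-↭)
open import Data.List.Relation.Binary.Permutation.Setoid.Properties (setoid ℕ) using (Unique-resp-↭)
open import Data.Product using (Σ; ∃₂; _×_; _,_; proj₁; proj₂)
open import Data.Sum as Sum using (_⊎_; inj₁; inj₂)
open import Data.Sum.Function.Propositional using (_⊎-⇔_)
open import Function.Base using (_∘_)
open import Function.Bundles using (_⇔_; mk⇔)
open import Function.Construct.Composition using (_⇔-∘_)
open import Function.Construct.Identity using (⇔-id)
open import Function.Construct.Symmetry using (⇔-sym)
open import Function.Properties.Equivalence using (⇔-setoid)
open import Induction.WellFounded using (Acc; acc)
open import Relation.Binary.Core using (Rel)
open import Relation.Binary.Definitions using (Transitive; DecidableEquality; tri<; tri≈; tri>)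
open import Relation.Nullary using (¬_; yes; no)
open import Relation.Unary using (Pred)

module _ {a p q} {A : Set a} {P : Pred A p} {Q : Pred A q} where

  First⇒lookup : ∀ {xs} → First P Q xs →
    Σ (Fin (length xs)) λ k → Q (lookup xs k) × (∀ j → j <ᶠ k → P (lookup xs j))
  First⇒lookup First.[ qx ] = zero , qx , λ _ ()
  First⇒lookup (px ∷ first) with First⇒lookup first
  ... | k , qk , before = suc k , qk , λ { zero _ → px ; (suc j) j<k → before j (s<s⁻¹ j<k) }

  lookup⇒First : ∀ {xs} (k : Fin (length xs)) → Q (lookup xs k) →
    (∀ j → j <ᶠ k → P (lookup xs j)) → First P Q xs
  lookup⇒First {_ ∷ _} zero qk _ = First.[ qk ]
  lookup⇒First {_ ∷ _} (suc k) qk before =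
    before zero z<s ∷ lookup⇒First k qk (λ j j<k → before (suc j) (s<s j<k))

Unique-++⁻ : ∀ {a} {A : Set a} (xs : List A) {ys} → Unique (xs ++ ys) → Unique xs × Unique ys
Unique-++⁻ [] unique = [] , unique
Unique-++⁻ (x ∷ xs) (x≢ ∷ unique) with Unique-++⁻ xs unique
... | unique-xs , unique-ys = All.++⁻ˡ xs x≢ ∷ unique-xs , unique-ys

module _ {a ℓ} {A : Set a} {R : Rel A ℓ} (trans : Transitive R) where

  Linked-∷ʳ⁻ : ∀ {y} xs → Linked R (xs ∷ʳ y) → Linked R xs × All (λ x → R x y) xs
  Linked-∷ʳ⁻ [] _ = [] , []
  Linked-∷ʳ⁻ (x ∷ []) (Rxy ∷ _) = [-] , Rxy ∷ []
  Linked-∷ʳ⁻ (x ∷ x′ ∷ xs) (Rxx′ ∷ linked) with Linked-∷ʳ⁻ (x′ ∷ xs) linked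
  ... | linked′ , Rx′y ∷ xs-R-y = Rxx′ ∷ linked′ , trans Rxx′ Rx′y ∷ Rx′y ∷ xs-R-y

module _ {a} {A : Set a} (_≟_ : DecidableEquality A) where

  split-at-first : ∀ {x} xs → x ∈ xs → ∃₂ λ L R → xs ≡ L ++ x ∷ R × All (_≢ x) L
  split-at-first {x} (y ∷ ys) x∈ with y ≟ x | x∈
  ... | yes refl | _         = [] , ys , refl , []
  ... | no y≢x   | here refl = ⊥-elim (y≢x refl)
  ... | no y≢x   | there x∈ys with split-at-first ys x∈ys
  ...   | L , R , refl , L≢x = y ∷ L , R , refl , y≢x ∷ L≢x

length-++-∷ : ∀ xs (m : ℕ) ys → length (xs ++ m ∷ ys) ≡ suc (length xs + length ys)
length-++-∷ xs m ys = trans (length-++ xs) (+-suc (length xs) (length ys))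

length-<-++-∷ : ∀ xs {m : ℕ} {ys} → length xs < length (xs ++ m ∷ ys)
length-<-++-∷ [] = z<s
length-<-++-∷ (_ ∷ xs) = s<s (length-<-++-∷ xs)

length-parts : ∀ {n} L (m : ℕ) R → length (L ++ m ∷ R) ≤ suc n → length L ≤ n × length R ≤ n
length-parts L m R ≤1+n with s≤s⁻¹ (subst (_≤ _) (length-++-∷ L m R) ≤1+n)
... | sum≤n = ≤-trans (m≤m+n _ _) sum≤n , ≤-trans (m≤n+m _ _) sum≤n

maxEntry-≤ : ∀ {m} xs → All (_≤ m) xs → maxEntry xs ≤ m
maxEntry-≤ [] [] = z≤n
maxEntry-≤ (x ∷ xs) (x≤m ∷ xs≤m) = ⊔-lub x≤m (maxEntry-≤ xs xs≤m)

maxEntry-∈ : ∀ x xs → maxEntry (x ∷ xs) ∈ x ∷ xs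
maxEntry-∈ x [] = here (⊔-identityʳ x)
maxEntry-∈ x (y ∷ ys) with ⊔-sel x (maxEntry (y ∷ ys))
... | inj₁ x⊔M≡x = here x⊔M≡x
... | inj₂ x⊔M≡M = there (subst (_∈ y ∷ ys) (sym x⊔M≡M) (maxEntry-∈ y ys))

maxEntry-++-∷ : ∀ {m} xs ys → All (_< m) xs → All (_≤ m) ys → maxEntry (xs ++ m ∷ ys) ≡ m
maxEntry-++-∷ [] ys [] ys≤m = m≥n⇒m⊔n≡m (maxEntry-≤ ys ys≤m)
maxEntry-++-∷ (x ∷ xs) ys (x<m ∷ xs<m) ys≤m
  rewrite maxEntry-++-∷ xs ys xs<m ys≤m = m≤n⇒m⊔n≡n (<⇒≤ x<m)

data SplitAtMax : List ℕ → Set where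
  []    : SplitAtMax []
  split : ∀ {P m B} → All (_< m) P → All (_< m) B → SplitAtMax (P ++ m ∷ B)

splitAtMax : ∀ xs → Unique xs → SplitAtMax xs
splitAtMax [] _ = []
splitAtMax (x ∷ xs) (x≢ ∷ unique) with splitAtMax xs unique
... | [] = split [] []
... | split {P} {m} {B} P<m B<m with <-cmp x m
...   | tri< x<m _ _ = split (x<m ∷ P<m) B<m
...   | tri≈ _ x≡m _ = ⊥-elim (All.lookup x≢ (∈-++⁺ʳ P (here refl)) x≡m)
...   | tri> _ _ m<x = split [] (All.++⁺ (All.map (λ y<m → <-trans y<m m<x) P<m)
                                         (m<x ∷ All.map (λ y<m → <-trans y<m m<x) B<m))

-- ℕ's _≟_ computes through _≡ᵇ_, so the clauses of break are selected by matching on it.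
break-at : ∀ {m} xs ys → All (_≢ m) xs → break (_≟ m) (xs ++ m ∷ ys) ≡ (xs , m ∷ ys)
break-at {m} [] ys [] with m ≡ᵇ m | ≡⇒≡ᵇ m m refl
... | true | _ = refl
break-at {m} (x ∷ xs) ys (x≢m ∷ xs≢m) with x ≡ᵇ m | ≡ᵇ⇒≡ x m
... | true  | x≡m = ⊥-elim (x≢m (x≡m tt))
... | false | _ rewrite break-at xs ys xs≢m = refl

break-at-max : ∀ {m} L R → All (_≢ m) L → maxEntry (L ++ m ∷ R) ≡ m →
  break (_≟ maxEntry (L ++ m ∷ R)) (L ++ m ∷ R) ≡ (L , m ∷ R)
break-at-max L R L≢m max≡m rewrite max≡m = break-at L R L≢m

sFuel-step : ∀ k x xs {L m R} → break (_≟ maxEntry (x ∷ xs)) (x ∷ xs) ≡ (L , m ∷ R) →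
  sFuel (suc k) (x ∷ xs) ≡ sFuel k L ++ sFuel k R ++ [ m ]
sFuel-step k x xs break≡ rewrite break≡ = refl

sFuel-unfold : ∀ k {m} L R → All (_≢ m) L → maxEntry (L ++ m ∷ R) ≡ m →
  sFuel (suc k) (L ++ m ∷ R) ≡ sFuel k L ++ sFuel k R ++ [ m ]
sFuel-unfold k [] R L≢m max≡m = sFuel-step k _ R (break-at-max [] R L≢m max≡m)
sFuel-unfold k (x ∷ L) R L≢m max≡m = sFuel-step k x _ (break-at-max (x ∷ L) R L≢m max≡m)

sFuel-stable : ∀ {k k′} xs → length xs ≤ k → length xs ≤ k′ → sFuel k xs ≡ sFuel k′ xs
sFuel-stable [] _ _ = refl
sFuel-stable {suc k} {suc k′} (x ∷ xs) ≤1+k ≤1+k′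
  with split-at-first _≟_ (x ∷ xs) (maxEntry-∈ x xs)
... | L , R , x∷xs≡ , L≢M = begin
  sFuel (suc k) (x ∷ xs)             ≡⟨ cong (sFuel (suc k)) x∷xs≡ ⟩
  sFuel (suc k) (L ++ M ∷ R)         ≡⟨ sFuel-unfold k L R L≢M max≡M ⟩
  sFuel k L ++ sFuel k R ++ [ M ]    ≡⟨ cong₂ (λ u v → u ++ v ++ [ M ])
                                         (sFuel-stable L (proj₁ L,R≤k) (proj₁ L,R≤k′))
                                         (sFuel-stable R (proj₂ L,R≤k) (proj₂ L,R≤k′)) ⟩
  sFuel k′ L ++ sFuel k′ R ++ [ M ]  ≡⟨ sFuel-unfold k′ L R L≢M max≡M ⟨
  sFuel (suc k′) (L ++ M ∷ R)        ≡⟨ cong (sFuel (suc k′)) x∷xs≡ ⟨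
  sFuel (suc k′) (x ∷ xs)            ∎
  where
  open ≡-Reasoning
  M = maxEntry (x ∷ xs)
  max≡M = sym (cong maxEntry x∷xs≡)
  parts≤ : ∀ {n} → length (x ∷ xs) ≤ suc n → length L ≤ n × length R ≤ n
  parts≤ ≤1+n = length-parts L M R (subst (λ l → length l ≤ _) x∷xs≡ ≤1+n)
  L,R≤k = parts≤ ≤1+k
  L,R≤k′ = parts≤ ≤1+k′

s-sFuel : ∀ {k} xs → length xs ≤ k → sFuel k xs ≡ s xs
s-sFuel xs ≤k = sFuel-stable xs ≤k ≤-refl

s-++-∷ : ∀ {m} xs ys → All (_< m) xs → All (_≤ m) ys → s (xs ++ m ∷ ys) ≡ s xs ++ s ys ++ [ m ]
s-++-∷ {m} xs ys xs<m ys≤m = begin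
  s (xs ++ m ∷ ys)
    ≡⟨ sFuel-stable (xs ++ m ∷ ys) ≤-refl (≤-reflexive (length-++-∷ xs m ys)) ⟩
  sFuel (suc n) (xs ++ m ∷ ys)
    ≡⟨ sFuel-unfold n xs ys (All.map <⇒≢ xs<m) (maxEntry-++-∷ xs ys xs<m ys≤m) ⟩
  sFuel n xs ++ sFuel n ys ++ [ m ]
    ≡⟨ cong₂ (λ u v → u ++ v ++ [ m ]) (s-sFuel xs (m≤m+n _ _)) (s-sFuel ys (m≤n+m _ _)) ⟩
  s xs ++ s ys ++ [ m ]
    ∎
  where
  open ≡-Reasoning
  n = length xs + length ys

s-increasing : ∀ {xs} → Linked _<_ xs → s xs ≡ xs
s-increasing {xs} = go (reverseView xs)
  where
  go : ∀ {ys} → Reverse ys → Linked _<_ ys → s ys ≡ ys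
  go [] _ = refl
  go (ys ∶ rev ∶ʳ y) linked with Linked-∷ʳ⁻ <-trans ys linked
  ... | linked′ , ys<y = trans (s-++-∷ ys [] ys<y []) (cong (_∷ʳ y) (go rev linked′))

IsLRmax′ : List ℕ → ℕ → Set
IsLRmax′ π x = First (_< x) (_≡ x) π

IsLRmax⇔IsLRmax′ : ∀ π x → IsLRmax π x ⇔ IsLRmax′ π x
IsLRmax⇔IsLRmax′ π x = mk⇔ (λ { (j , refl , before) → lookup⇒First j refl before }) from
  where
  from : IsLRmax′ π x → IsLRmax π x
  from lrmax with First⇒lookup lrmax
  ... | k , refl , before = k , refl , before

IsLRmax′-++-∷ : ∀ {m x} xs ys → All (_< m) xs → All (_< m) ys →
  IsLRmax′ (xs ++ m ∷ ys) x ⇔ (IsLRmax′ xs x ⊎ x ≡ m)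
IsLRmax′-++-∷ {m} {x} xs ys xs<m ys<m =
  mk⇔ (to xs xs<m) Sum.[ (λ lrmax → First.⁺++ lrmax _) , (λ { refl → First.++⁺ xs<m First.[ refl ] }) ]
  where
  to : ∀ xs → All (_< m) xs → IsLRmax′ (xs ++ m ∷ ys) x → IsLRmax′ xs x ⊎ x ≡ m
  to [] _ First.[ m≡x ] = inj₂ (sym m≡x)
  to [] _ (m<x ∷ lrmax) =
    ⊥-elim (First.All⇒¬First (λ y<x y≡x → <-irrefl y≡x y<x)
                              (All.map (λ y<m → <-trans y<m m<x) ys<m) lrmax)
  to (y ∷ xs) _ First.[ y≡x ] = inj₁ First.[ y≡x ]
  to (y ∷ xs) (_ ∷ xs<m) (y<x ∷ lrmax) = Sum.map₁ (y<x ∷_) (to xs xs<m lrmax)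

-- a ∷ π contains 32‾41 with a as its '3'.
Completes32b41 : ℕ → List ℕ → Set
Completes32b41 a [] = ⊥
Completes32b41 a (b ∷ π) = (b < a × First (_< a) (_< b) π) ⊎ Completes32b41 a π

Contains32b41′ : List ℕ → Set
Contains32b41′ [] = ⊥
Contains32b41′ (a ∷ π) = Completes32b41 a π ⊎ Contains32b41′ π

Completes32b41At : ℕ → List ℕ → Set
Completes32b41At a π = Σ (Fin (length π)) λ i → Σ (Fin (length π)) λ k →
  (i <ᶠ k) × (lookup π i < a) × (lookup π k < lookup π i) ×
  (∀ j → i <ᶠ j → j <ᶠ k → lookup π j < a)

Completes32b41At⇒Completes32b41 : ∀ {a} π → Completes32b41At a π → Completes32b41 a π
Completes32b41At⇒Completes32b41 (b ∷ π) (zero , suc k , _ , b<a , c<b , gap) =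
  inj₁ (b<a , lookup⇒First k c<b (λ j j<k → gap (suc j) z<s (s<s j<k)))
Completes32b41At⇒Completes32b41 (b ∷ π) (suc i , suc k , i<k , b<a , c<b , gap) =
  inj₂ (Completes32b41At⇒Completes32b41 π
         (i , k , s<s⁻¹ i<k , b<a , c<b , λ j i<j j<k → gap (suc j) (s<s i<j) (s<s j<k)))

Completes32b41⇒Completes32b41At : ∀ {a} π → Completes32b41 a π → Completes32b41At a π
Completes32b41⇒Completes32b41At (b ∷ π) (inj₁ (b<a , first)) with First⇒lookup first
... | k , c<b , before = zero , suc k , z<s , b<a , c<b , λ { (suc j) _ j<k → before j (s<s⁻¹ j<k) }
Completes32b41⇒Completes32b41At (b ∷ π) (inj₂ completes) with Completes32b41⇒Completes32b41At π completes
... | i , k , i<k , b<a , c<b , gap =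
  suc i , suc k , s<s i<k , b<a , c<b , λ { (suc j) i<j j<k → gap j (s<s⁻¹ i<j) (s<s⁻¹ j<k) }

Contains32b41⇒Contains32b41′ : ∀ π → Contains32b41 π → Contains32b41′ π
Contains32b41⇒Contains32b41′ (a ∷ π) (zero , suc i , suc k , _ , i<k , b<a , c<b , gap) =
  inj₁ (Completes32b41At⇒Completes32b41 π
         (i , k , s<s⁻¹ i<k , b<a , c<b , λ j i<j j<k → gap (suc j) (s<s i<j) (s<s j<k)))
Contains32b41⇒Contains32b41′ (a ∷ π) (suc h , suc i , suc k , h<i , i<k , b<a , c<b , gap) =
  inj₂ (Contains32b41⇒Contains32b41′ π
         (h , i , k , s<s⁻¹ h<i , s<s⁻¹ i<k , b<a , c<b , λ j i<j j<k → gap (suc j) (s<s i<j) (s<s j<k)))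

Contains32b41′⇒Contains32b41 : ∀ π → Contains32b41′ π → Contains32b41 π
Contains32b41′⇒Contains32b41 (a ∷ π) (inj₁ completes) with Completes32b41⇒Completes32b41At π completes
... | i , k , i<k , b<a , c<b , gap =
  zero , suc i , suc k , z<s , s<s i<k , b<a , c<b , λ { (suc j) i<j j<k → gap j (s<s⁻¹ i<j) (s<s⁻¹ j<k) }
Contains32b41′⇒Contains32b41 (a ∷ π) (inj₂ contains) with Contains32b41′⇒Contains32b41 π contains
... | h , i , k , h<i , i<k , b<a , c<b , gap =
  suc h , suc i , suc k , s<s h<i , s<s i<k , b<a , c<b , λ { (suc j) i<j j<k → gap j (s<s⁻¹ i<j) (s<s⁻¹ j<k) }

Completes32b41-++⁺ˡ : ∀ {a} xs ys → Completes32b41 a xs → Completes32b41 a (xs ++ ys)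
Completes32b41-++⁺ˡ (b ∷ xs) ys (inj₁ (b<a , first)) = inj₁ (b<a , First.⁺++ first ys)
Completes32b41-++⁺ˡ (b ∷ xs) ys (inj₂ completes) = inj₂ (Completes32b41-++⁺ˡ xs ys completes)

Contains32b41′-++⁺ˡ : ∀ xs ys → Contains32b41′ xs → Contains32b41′ (xs ++ ys)
Contains32b41′-++⁺ˡ (a ∷ xs) ys (inj₁ completes) = inj₁ (Completes32b41-++⁺ˡ xs ys completes)
Contains32b41′-++⁺ˡ (a ∷ xs) ys (inj₂ contains) = inj₂ (Contains32b41′-++⁺ˡ xs ys contains)

Contains32b41′-++⁺ʳ : ∀ xs {ys} → Contains32b41′ ys → Contains32b41′ (xs ++ ys)
Contains32b41′-++⁺ʳ [] contains = contains
Contains32b41′-++⁺ʳ (_ ∷ xs) contains = inj₂ (Contains32b41′-++⁺ʳ xs contains)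

-- A descent x > y of B is an occurrence with a, x, y as '3', '2', '1'.
Completes32b41-free⇒increasing : ∀ {a} B E → All (_< a) B → Unique B → ¬ Completes32b41 a (B ++ E) →
  Linked _<_ B
Completes32b41-free⇒increasing [] _ _ _ _ = []
Completes32b41-free⇒increasing (_ ∷ []) _ _ _ _ = [-]
Completes32b41-free⇒increasing (x ∷ y ∷ B) E (x<a ∷ B<a) ((x≢y ∷ _) ∷ unique) free with y <? x
... | yes y<x = ⊥-elim (free (inj₁ (x<a , First.[ y<x ])))
... | no y≮x  =
  ≤∧≢⇒< (≮⇒≥ y≮x) x≢y ∷ Completes32b41-free⇒increasing (y ∷ B) E B<a unique (free ∘ inj₂)

-- M is the largest entry to the left of the list.
DescentTopsAreLRmax : ℕ → List ℕ → Set
DescentTopsAreLRmax M [] = ⊤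
DescentTopsAreLRmax M (x ∷ []) = ⊤
DescentTopsAreLRmax M (x ∷ y ∷ σ) = (y < x → M ≤ x) × DescentTopsAreLRmax (M ⊔ x) (y ∷ σ)

DescentTopsAreLRmax-tail : ∀ {M x} xs → DescentTopsAreLRmax M (x ∷ xs) → DescentTopsAreLRmax (M ⊔ x) xs
DescentTopsAreLRmax-tail [] _ = tt
DescentTopsAreLRmax-tail (_ ∷ _) (_ , tops) = tops

Linked⇒DescentTopsAreLRmax : ∀ {M xs} → Linked _<_ xs → DescentTopsAreLRmax M xs
Linked⇒DescentTopsAreLRmax [] = tt
Linked⇒DescentTopsAreLRmax [-] = tt
Linked⇒DescentTopsAreLRmax (x<y ∷ linked) =
  (λ y<x → ⊥-elim (<-asym x<y y<x)) , Linked⇒DescentTopsAreLRmax linked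

DescentTopsAreLRmax-++-∷ : ∀ {M m} σ B → DescentTopsAreLRmax M σ → All (_< m) σ → M ≤ m →
  Linked _<_ B → DescentTopsAreLRmax M (σ ++ m ∷ B)
DescentTopsAreLRmax-++-∷ [] [] _ _ _ _ = tt
DescentTopsAreLRmax-++-∷ [] (_ ∷ _) _ _ M≤m linked = (λ _ → M≤m) , Linked⇒DescentTopsAreLRmax linked
DescentTopsAreLRmax-++-∷ (x ∷ []) B _ (x<m ∷ []) M≤m linked =
  (λ m<x → ⊥-elim (<-asym x<m m<x)) , DescentTopsAreLRmax-++-∷ [] B tt [] (⊔-lub M≤m (<⇒≤ x<m)) linked
DescentTopsAreLRmax-++-∷ (x ∷ y ∷ σ) B (top , tops) (x<m ∷ σ<m) M≤m linked =
  top , DescentTopsAreLRmax-++-∷ (y ∷ σ) B tops σ<m (⊔-lub M≤m (<⇒≤ x<m)) linked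

-- Walking from the '2' (at most t) to the '1', every entry stays below a ≤ M, so the first descent
-- met has a top below M.
DescentTopsAreLRmax⇒¬First : ∀ {M a b t} zs → a ≤ M → b ≤ t → t < a →
  DescentTopsAreLRmax M (t ∷ zs) → ¬ First (_< a) (_< b) zs
DescentTopsAreLRmax⇒¬First (w ∷ ws) a≤M b≤t t<a (top , _) First.[ w<b ] =
  <⇒≱ t<a (≤-trans a≤M (top (<-≤-trans w<b b≤t)))
DescentTopsAreLRmax⇒¬First {M} {t = t} (w ∷ ws) a≤M b≤t t<a (top , tops) (w<a ∷ first) with w <? t
... | yes w<t = <⇒≱ t<a (≤-trans a≤M (top w<t))
... | no w≮t  =
  DescentTopsAreLRmax⇒¬First ws (≤-trans a≤M (m≤m⊔n M t)) (≤-trans b≤t (≮⇒≥ w≮t)) w<a tops first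

DescentTopsAreLRmax⇒¬Completes32b41 : ∀ {M a} zs → a ≤ M → DescentTopsAreLRmax M zs →
  ¬ Completes32b41 a zs
DescentTopsAreLRmax⇒¬Completes32b41 (z ∷ zs) a≤M tops (inj₁ (z<a , first)) =
  DescentTopsAreLRmax⇒¬First zs a≤M ≤-refl z<a tops first
DescentTopsAreLRmax⇒¬Completes32b41 {M} (z ∷ zs) a≤M tops (inj₂ completes) =
  DescentTopsAreLRmax⇒¬Completes32b41 zs (≤-trans a≤M (m≤m⊔n M z))
    (DescentTopsAreLRmax-tail zs tops) completes

DescentTopsAreLRmax⇒¬Contains32b41′ : ∀ {M} σ → DescentTopsAreLRmax M σ → ¬ Contains32b41′ σ
DescentTopsAreLRmax⇒¬Contains32b41′ {M} (a ∷ σ) tops (inj₁ completes) =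
  DescentTopsAreLRmax⇒¬Completes32b41 σ (m≤n⊔m M a) (DescentTopsAreLRmax-tail σ tops) completes
DescentTopsAreLRmax⇒¬Contains32b41′ (a ∷ σ) tops (inj₂ contains) =
  DescentTopsAreLRmax⇒¬Contains32b41′ σ (DescentTopsAreLRmax-tail σ tops) contains

record GoodPreimage (π : List ℕ) : Set where
  field
    σ         : List ℕ
    σ↭π       : σ ↭ π
    sorts     : s σ ≡ π
    tops      : DescentTopsAreLRmax 0 σ
    sameLRmax : ∀ x → IsLRmax′ σ x ⇔ IsLRmax′ π x

preimage : ∀ {L} m → SplitAtMax L → Acc _<_ (length L) → Unique L → ¬ Contains32b41′ (L ++ [ m ]) →
  All (_< m) L → GoodPreimage (L ++ [ m ])
preimage m [] _ _ _ _ = record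
  { σ = [ m ] ; σ↭π = ↭-refl ; sorts = s-++-∷ [] [] [] [] ; tops = tt ; sameLRmax = λ _ → ⇔-id _ }
preimage m (split {P} {m′} {B} P<m′ B<m′) (acc rec) unique avoids L<m = record
  { σ = σ′ ++ m ∷ B
  ; σ↭π = σ↭π
  ; sorts = sorts
  ; tops = DescentTopsAreLRmax-++-∷ σ′ B tops′ σ′<m z≤n increasing
  ; sameLRmax = sameLRmax
  }
  where
  unique-P = proj₁ (Unique-++⁻ P unique)
  unique-B : Unique B
  unique-B with Unique-++⁻ P unique
  ... | _ , (_ ∷ unique-B) = unique-B
  m′<m = All.lookup L<m (∈-++⁺ʳ P (here refl))
  B<m = All.map (λ b<m′ → <-trans b<m′ m′<m) B<m′
  Pm′<m = All.++⁺ (All.++⁻ˡ P L<m) (m′<m ∷ [])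
  reassoc : (P ++ [ m′ ]) ++ B ++ [ m ] ≡ (P ++ m′ ∷ B) ++ [ m ]
  reassoc = trans (++-assoc P [ m′ ] (B ++ [ m ])) (sym (++-assoc P (m′ ∷ B) [ m ]))
  increasing = Completes32b41-free⇒increasing B [ m ] B<m′ unique-B
    (avoids ∘ subst Contains32b41′ (sym (++-assoc P (m′ ∷ B) [ m ])) ∘ Contains32b41′-++⁺ʳ P ∘ inj₁)
  open GoodPreimage (preimage m′ (splitAtMax P unique-P) (rec (length-<-++-∷ P)) unique-P
    (avoids ∘ subst Contains32b41′ reassoc ∘ Contains32b41′-++⁺ˡ (P ++ [ m′ ]) (B ++ [ m ])) P<m′)
    renaming (σ to σ′; σ↭π to σ′↭Pm′; sorts to sorts′; tops to tops′; sameLRmax to sameLRmax′)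
  σ′<m = All-resp-↭ (↭-sym σ′↭Pm′) Pm′<m
  σ↭π : σ′ ++ m ∷ B ↭ (P ++ m′ ∷ B) ++ [ m ]
  σ↭π = begin
    σ′ ++ m ∷ B                  ↭⟨ ++⁺ʳ (m ∷ B) σ′↭Pm′ ⟩
    (P ++ [ m′ ]) ++ m ∷ B       ↭⟨ ++⁺ˡ (P ++ [ m′ ]) (++-comm [ m ] B) ⟩
    (P ++ [ m′ ]) ++ B ++ [ m ]  ≡⟨ reassoc ⟩
    (P ++ m′ ∷ B) ++ [ m ]       ∎
    where open PermutationReasoning
  sorts : s (σ′ ++ m ∷ B) ≡ (P ++ m′ ∷ B) ++ [ m ]
  sorts = begin
    s (σ′ ++ m ∷ B)              ≡⟨ s-++-∷ σ′ B σ′<m (All.map <⇒≤ B<m) ⟩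
    s σ′ ++ s B ++ [ m ]         ≡⟨ cong₂ (λ u v → u ++ v ++ [ m ]) sorts′ (s-increasing increasing) ⟩
    (P ++ [ m′ ]) ++ B ++ [ m ]  ≡⟨ reassoc ⟩
    (P ++ m′ ∷ B) ++ [ m ]       ∎
    where open ≡-Reasoning
  sameLRmax : ∀ x → IsLRmax′ (σ′ ++ m ∷ B) x ⇔ IsLRmax′ ((P ++ m′ ∷ B) ++ [ m ]) x
  sameLRmax x = begin
    IsLRmax′ (σ′ ++ m ∷ B) x               ≈⟨ IsLRmax′-++-∷ σ′ B σ′<m B<m ⟩
    (IsLRmax′ σ′ x ⊎ x ≡ m)                ≈⟨ sameLRmax′ x ⊎-⇔ ⇔-id _ ⟩
    (IsLRmax′ (P ++ [ m′ ]) x ⊎ x ≡ m)     ≈⟨ IsLRmax′-++-∷ P [] P<m′ [] ⊎-⇔ ⇔-id _ ⟩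
    ((IsLRmax′ P x ⊎ x ≡ m′) ⊎ x ≡ m)      ≈⟨ IsLRmax′-++-∷ P B P<m′ B<m′ ⊎-⇔ ⇔-id _ ⟨
    (IsLRmax′ (P ++ m′ ∷ B) x ⊎ x ≡ m)     ≈⟨ IsLRmax′-++-∷ (P ++ m′ ∷ B) [] L<m [] ⟨
    IsLRmax′ ((P ++ m′ ∷ B) ++ [ m ]) x    ∎
    where open import Relation.Binary.Reasoning.Setoid (⇔-setoid 0ℓ)

lemma3p1 : (π : List ℕ) → IsPerm π → Avoids32b41 π → EndsInMax π →
    Σ (List ℕ) λ σ → IsPerm σ × (s σ ≡ π) × Avoids32b41 σ × SameLRmax σ π
lemma3p1 π (unique , positive) avoids (L , m , refl , L<m) =
  σ ,
  (Unique-resp-↭ (↭⇒↭ₛ (↭-sym σ↭π)) unique , All-resp-↭ (↭-sym σ↭π) positive) ,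
  sorts ,
  DescentTopsAreLRmax⇒¬Contains32b41′ σ tops ∘ Contains32b41⇒Contains32b41′ σ ,
  λ x → ⇔-sym (IsLRmax⇔IsLRmax′ π x) ⇔-∘ (sameLRmax x ⇔-∘ IsLRmax⇔IsLRmax′ σ x)
  where
  unique-L = proj₁ (Unique-++⁻ L unique)
  open GoodPreimage (preimage m (splitAtMax L unique-L) (<-wellFounded (length L)) unique-L
                       (avoids ∘ Contains32b41′⇒Contains32b41 π) L<m)
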